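{- For every integer $n\ge1$, $b(C_{n,n+2})=n+1$.
   Context: The burning number of a graph $G$ is $b(G)=\min\{k : \exists v_1,\dots,v_k\in V(G) \text{ with } V(G)=\bigcup_{i=1}^k B(v_i,k-i)\}$, where $B(v,r)$ is the set of vertices at graph distance at most $r$ from $v$. The comb graph $C_{n,m}$ has vertex set $\{(i,j): 1\le i\le m,\ 1\le j\le n\}$ with edges $(1,j)\sim(1,j+1)$ for $1\le j<n$ (the spine) and $(i,j)\sim(i+1,j)$ for $1\le i<m$ (tooth $j$). -}

module Defs where

open import Data.Nat using (ℕ; zero; suc; _+_; _∸_; _≤_)
open import Data.Fin using (Fin; toℕ)
open import Data.Product using (_×_; _,_; Σ; ∃-syntax)
open import Relation.Binary.PropositionalEquality using (_≡_)

record Graph : Set₁ where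
  field
    V   : Set
    Adj : V → V → Set
open Graph public

data Walk (G : Graph) : V G → V G → Set where
  [] : ∀ {u} → Walk G u u
  _∷_ : ∀ {u v w} → Adj G u v → Walk G v w → Walk G u w

walkLength : ∀ {G u v} → Walk G u v → ℕ
walkLength [] = 0
walkLength (_ ∷ w) = suc (walkLength w)

InBall : (G : Graph) → V G → ℕ → V G → Set
InBall G v r u = Σ (Walk G v u) λ w → walkLength w ≤ r

-- Sources v₁,…,v_k (0-indexed as v 0,…,v (k-1)) burn G in k steps:
-- V(G) = ⋃_{i=1}^k B(v_i, k-i).  With 0-indexed i the radius is k ∸ suc i.
Burns : (G : Graph) (k : ℕ) → (Fin k → V G) → Set
Burns G k v = ∀ u → ∃[ i ] InBall G (v i) (k ∸ suc (toℕ i)) u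

Burnable : Graph → ℕ → Set
Burnable G k = ∃[ v ] Burns G k v

BurningNumberIs : Graph → ℕ → Set
BurningNumberIs G b = Burnable G b × (∀ k → Burnable G k → b ≤ k)

-- The comb C_{n,m}: vertices (i , j) with i ∈ Fin m (row; i = 0 is the spine,
-- corresponding to the paper's i = 1) and j ∈ Fin n (column / tooth index).
data CombAdj (n m : ℕ) : (Fin m × Fin n) → (Fin m × Fin n) → Set where
  spine⁺ : ∀ {i j j'} → toℕ i ≡ 0 → suc (toℕ j) ≡ toℕ j' → CombAdj n m (i , j) (i , j')
  spine⁻ : ∀ {i j j'} → toℕ i ≡ 0 → toℕ j ≡ suc (toℕ j') → CombAdj n m (i , j) (i , j')
  tooth⁺ : ∀ {i i' j} → suc (toℕ i) ≡ toℕ i' → CombAdj n m (i , j) (i' , j)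
  tooth⁻ : ∀ {i i' j} → toℕ i ≡ suc (toℕ i') → CombAdj n m (i , j) (i' , j)

Comb : ℕ → ℕ → Graph
Comb n m = record { V = Fin m × Fin n ; Adj = CombAdj n m }

-- A vertex at depth ≥ k is farther than k from every vertex on another tooth, since a
-- walk between teeth passes through the spine.  So if k + 1 sources burn a comb with
-- two rows of depth ≥ k, the sources covering such a row lie on pairwise distinct teeth.
-- Choosing that row to avoid the last source, whose ball is a single vertex, gives an
-- injection from the n teeth into the first k sources.  Conversely, for C_{n,n+2}, a source
-- at the end of the spine with radius n covers every (i , j) with i ≤ j + 1, and a
-- source of radius n - 1 - j at the tip of tooth j covers the rest of that tooth.
module Submission where

open import Defs
open import Data.Nat using (ℕ; zero; suc; _+_; _∸_; _≤_; _<_; z≤n; s≤s; _≤?_)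
open import Data.Nat.Properties
open import Data.Fin as Fin using (Fin; toℕ; fromℕ; fromℕ<; inject₁; punchOut)
open import Data.Fin.Properties
  using (toℕ-injective; toℕ-fromℕ; toℕ-fromℕ<; toℕ-inject₁; toℕ<n; fromℕ≢inject₁; punchOut-injective; injective⇒≤)
open import Data.Product using (_×_; _,_; proj₁; proj₂)
open import Data.Sum using (inj₁; inj₂)
open import Function using (_∘_)
open import Relation.Nullary using (yes; no; contradiction)
open import Relation.Nullary.Decidable using (decidable-stable)
open import Relation.Binary.PropositionalEquality

module _ {G : Graph} where

  ball-zero : ∀ {u v} → InBall G u 0 v → u ≡ v
  ball-zero ([] , _) = refl

  ball-mono : ∀ {u v r s} → r ≤ s → InBall G u r v → InBall G u s v
  ball-mono r≤s (w , ∣w∣≤r) = w , ≤-trans ∣w∣≤r r≤s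

  ball-cons : ∀ {u v w r} → Adj G u v → InBall G v r w → InBall G u (suc r) w
  ball-cons e (w , ∣w∣≤r) = e ∷ w , s≤s ∣w∣≤r

  ball-++ : ∀ {u v w r s} → InBall G u r v → InBall G v s w → InBall G u (r + s) w
  ball-++ {r = r} {s} ([] , _) q = ball-mono (m≤n+m s r) q
  ball-++ (e ∷ w , s≤s ∣w∣≤r) q = ball-cons e (ball-++ (w , ∣w∣≤r) q)

  potential≤walkLength : (D : V G → ℕ) → (∀ {u v} → Adj G u v → D u ≤ suc (D v)) →
                         ∀ {u t} → D t ≡ 0 → (w : Walk G u t) → D u ≤ walkLength w
  potential≤walkLength D lipschitz Dt≡0 [] = ≤-reflexive Dt≡0
  potential≤walkLength D lipschitz Dt≡0 (e ∷ w) =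
    ≤-trans (lipschitz e) (s≤s (potential≤walkLength D lipschitz Dt≡0 w))

  module _ {m} (p : Fin m → V G) where

    ascent : (∀ {x y} → suc (toℕ x) ≡ toℕ y → Adj G (p x) (p y)) →
             ∀ d {x y} → toℕ x + d ≡ toℕ y → InBall G (p x) d (p y)
    ascent step zero {x} eq rewrite toℕ-injective (trans (sym (+-identityʳ (toℕ x))) eq) = [] , z≤n
    ascent step (suc d) {x} {y} eq = ball-cons (step (sym (toℕ-fromℕ< x+1<m))) (ascent step d x+1+d≡y)
      where
      x+1+d≡y′ : suc (toℕ x) + d ≡ toℕ y
      x+1+d≡y′ = trans (sym (+-suc (toℕ x) d)) eq
      x+1<m : suc (toℕ x) < m
      x+1<m = ≤-trans (s≤s (≤-trans (m≤m+n (suc (toℕ x)) d) (≤-reflexive x+1+d≡y′))) (toℕ<n y)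
      x+1+d≡y : toℕ (fromℕ< x+1<m) + d ≡ toℕ y
      x+1+d≡y = trans (cong (_+ d) (toℕ-fromℕ< x+1<m)) x+1+d≡y′

    descent : (∀ {x y} → toℕ x ≡ suc (toℕ y) → Adj G (p x) (p y)) →
              ∀ d {x y} → toℕ y + d ≡ toℕ x → InBall G (p x) d (p y)
    descent step zero {x} {y} eq rewrite toℕ-injective (trans (sym (+-identityʳ (toℕ y))) eq) = [] , z≤n
    descent step (suc d) {x} {y} eq = ball-cons (step x≡1+mid) (descent step d (sym (toℕ-fromℕ< y+d<m)))
      where
      y+d<m : toℕ y + d < m
      y+d<m = ≤-trans (≤-reflexive (trans (sym (+-suc (toℕ y) d)) eq)) (<⇒≤ (toℕ<n x))
      x≡1+mid : toℕ x ≡ suc (toℕ (fromℕ< y+d<m))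
      x≡1+mid = trans (sym eq) (trans (+-suc (toℕ y) d) (cong suc (sym (toℕ-fromℕ< y+d<m))))

m∸n≤1+m∸1+n : ∀ m n → m ∸ n ≤ suc (m ∸ suc n)
m∸n≤1+m∸1+n zero    zero    = z≤n
m∸n≤1+m∸1+n zero    (suc n) = z≤n
m∸n≤1+m∸1+n (suc m) zero    = ≤-refl
m∸n≤1+m∸1+n (suc m) (suc n) = m∸n≤1+m∸1+n m n

module _ {n m : ℕ} where

  tooth-ascent : ∀ (j : Fin n) d {x y : Fin m} → toℕ x + d ≡ toℕ y → InBall (Comb n m) (x , j) d (y , j)
  tooth-ascent j = ascent (_, j) tooth⁺

  tooth-descent : ∀ (j : Fin n) d {x y : Fin m} → toℕ y + d ≡ toℕ x → InBall (Comb n m) (x , j) d (y , j)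
  tooth-descent j = descent (_, j) tooth⁻

  spine-descent : ∀ (o : Fin m) → toℕ o ≡ 0 → ∀ d {x y : Fin n} → toℕ y + d ≡ toℕ x →
                  InBall (Comb n m) (o , x) d (o , y)
  spine-descent o o≡0 = descent (o ,_) (spine⁻ o≡0)

  -- A 1-Lipschitz lower bound for the distance to (c , d): off tooth d a walk must
  -- still reach the spine (row 0) and then climb c rows.
  module _ (c : Fin m) (d : Fin n) where

    potential : Fin m × Fin n → ℕ
    potential (a , b) with b Fin.≟ d
    ... | yes _ = toℕ c ∸ toℕ a
    ... | no  _ = suc (toℕ c)

    potential-lipschitz : ∀ {u v} → CombAdj n m u v → potential u ≤ suc (potential v)
    potential-lipschitz {a , b} {_ , b′} (spine⁺ a≡0 b+1≡b′) with b Fin.≟ d | b′ Fin.≟ d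
    ... | yes refl | yes refl = contradiction b+1≡b′ (1+n≢n)
    ... | yes _    | no  _    = m≤n⇒m≤1+n (m≤n⇒m≤1+n (m∸n≤m (toℕ c) (toℕ a)))
    ... | no  _    | yes _    rewrite a≡0 = ≤-refl
    ... | no  _    | no  _    = n≤1+n _
    potential-lipschitz {a , b} {_ , b′} (spine⁻ a≡0 b≡b′+1) with b Fin.≟ d | b′ Fin.≟ d
    ... | yes refl | yes refl = contradiction (sym b≡b′+1) (1+n≢n)
    ... | yes _    | no  _    = m≤n⇒m≤1+n (m≤n⇒m≤1+n (m∸n≤m (toℕ c) (toℕ a)))
    ... | no  _    | yes _    rewrite a≡0 = ≤-refl
    ... | no  _    | no  _    = n≤1+n _
    potential-lipschitz {a , b} (tooth⁺ a+1≡a′) with b Fin.≟ d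
    ... | yes _ rewrite sym a+1≡a′ = m∸n≤1+m∸1+n (toℕ c) (toℕ a)
    ... | no  _ = n≤1+n _
    potential-lipschitz {a , b} {a′ , _} (tooth⁻ a≡a′+1) with b Fin.≟ d
    ... | yes _ rewrite a≡a′+1 = m≤n⇒m≤1+n (∸-monoʳ-≤ (toℕ c) (n≤1+n (toℕ a′)))
    ... | no  _ = n≤1+n _

    potential-target : potential (c , d) ≡ 0
    potential-target with d Fin.≟ d
    ... | yes _ = n∸n≡0 (toℕ c)
    ... | no d≢d = contradiction refl d≢d

    cross-tooth-walkLength : ∀ {a b} (w : Walk (Comb n m) (a , b) (c , d)) → b ≢ d → suc (toℕ c) ≤ walkLength w
    cross-tooth-walkLength {a} {b} w b≢d with potential≤walkLength potential potential-lipschitz potential-target w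
    ... | D≤∣w∣ with b Fin.≟ d
    ...   | yes b≡d = contradiction b≡d b≢d
    ...   | no  _   = D≤∣w∣

  deep-ball-same-tooth : ∀ {r s} {x : Fin m} {j : Fin n} → r ≤ toℕ x →
                         InBall (Comb n m) s r (x , j) → proj₂ s ≡ j
  deep-ball-same-tooth {s = s} {x} {j} r≤x (w , ∣w∣≤r) = decidable-stable (proj₂ s Fin.≟ j) λ s≢j →
    <⇒≱ (cross-tooth-walkLength x j w s≢j) (≤-trans ∣w∣≤r r≤x)

  -- v (fromℕ k) is the source of radius 0.
  teeth≤sources : ∀ {k} (v : Fin (suc k) → Fin m × Fin n) → Burns (Comb n m) (suc k) v →
                  (ρ : Fin m) → k ≤ toℕ ρ → ρ ≢ proj₁ (v (fromℕ k)) → n ≤ k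
  teeth≤sources {k} v burns ρ k≤ρ ρ≢last = injective⇒≤ index-injective
    where
    covering : Fin n → Fin (suc k)
    covering j = proj₁ (burns (ρ , j))

    covering-tooth : ∀ j → proj₂ (v (covering j)) ≡ j
    covering-tooth j = deep-ball-same-tooth (≤-trans (m∸n≤m k (toℕ (covering j))) k≤ρ) (proj₂ (burns (ρ , j)))

    last≢covering : ∀ j → fromℕ k ≢ covering j
    last≢covering j last≡i = ρ≢last (sym (cong proj₁ (ball-zero (ball-mono radius≤0 ball))))
      where
      ball : InBall (Comb n m) (v (fromℕ k)) (k ∸ toℕ (fromℕ k)) (ρ , j)
      ball = subst (λ i → InBall (Comb n m) (v i) (k ∸ toℕ i) (ρ , j)) (sym last≡i) (proj₂ (burns (ρ , j)))
      radius≤0 : k ∸ toℕ (fromℕ k) ≤ 0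
      radius≤0 = ≤-reflexive (trans (cong (k ∸_) (toℕ-fromℕ k)) (n∸n≡0 k))

    index : Fin n → Fin k
    index j = punchOut (last≢covering j)

    index-injective : ∀ {j j′} → index j ≡ index j′ → j ≡ j′
    index-injective {j} {j′} eq = trans (sym (covering-tooth j))
      (trans (cong (λ i → proj₂ (v i)) (punchOut-injective (last≢covering j) (last≢covering j′) eq))
             (covering-tooth j′))

  two-deep-rows⇒teeth≤sources : ∀ {k} (ρ ρ′ : Fin m) → ρ ≢ ρ′ → k ≤ toℕ ρ → k ≤ toℕ ρ′ →
                                Burnable (Comb n m) (suc k) → n ≤ k
  two-deep-rows⇒teeth≤sources {k} ρ ρ′ ρ≢ρ′ k≤ρ k≤ρ′ (v , burns) with ρ Fin.≟ proj₁ (v (fromℕ k))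
  ... | yes refl = teeth≤sources v burns ρ′ k≤ρ′ (ρ≢ρ′ ∘ sym)
  ... | no ρ≢last = teeth≤sources v burns ρ k≤ρ ρ≢last

module _ (n : ℕ) where

  private
    G : Graph
    G = Comb (suc n) (2 + suc n)

  tip : Fin (2 + suc n)
  tip = fromℕ (suc (suc n))

  spine-tip-sources : Fin (1 + suc n) → Fin (2 + suc n) × Fin (suc n)
  spine-tip-sources Fin.zero    = Fin.zero , fromℕ n
  spine-tip-sources (Fin.suc j) = tip , j

  spine-tip-sources-burn : Burns G (1 + suc n) spine-tip-sources
  spine-tip-sources-burn (a , j) with toℕ a ≤? suc (toℕ j)
  ... | yes a≤j+1 = Fin.zero , ball-mono length≤n+1 (ball-++ along-spine up-tooth)
    where
    j≤n : toℕ j ≤ n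
    j≤n = ≤-pred (toℕ<n j)
    along-spine : InBall G (Fin.zero , fromℕ n) (n ∸ toℕ j) (Fin.zero , j)
    along-spine = spine-descent Fin.zero refl (n ∸ toℕ j) (trans (m+[n∸m]≡n j≤n) (sym (toℕ-fromℕ n)))
    up-tooth : InBall G (Fin.zero , j) (toℕ a) (a , j)
    up-tooth = tooth-ascent j (toℕ a) refl
    length≤n+1 : n ∸ toℕ j + toℕ a ≤ suc n
    length≤n+1 = ≤-trans (+-monoʳ-≤ (n ∸ toℕ j) a≤j+1)
                         (≤-reflexive (trans (+-suc (n ∸ toℕ j) (toℕ j)) (cong suc (m∸n+n≡m j≤n))))
  ... | no a≰j+1 = Fin.suc j , ball-mono (∸-monoʳ-≤ (suc (suc n)) (≰⇒> a≰j+1)) down-tooth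
    where
    a≤tip : toℕ a ≤ suc (suc n)
    a≤tip = ≤-pred (toℕ<n a)
    down-tooth : InBall G (tip , j) (suc (suc n) ∸ toℕ a) (a , j)
    down-tooth = tooth-descent j (suc (suc n) ∸ toℕ a) (trans (m+[n∸m]≡n a≤tip) (sym (toℕ-fromℕ (suc (suc n)))))

  comb-burning-lower : ∀ k → Burnable G k → 1 + suc n ≤ k
  comb-burning-lower zero (v , burns) with burns (Fin.zero , Fin.zero)
  ... | () , _
  comb-burning-lower (suc k) burnable with ≤-total (suc n) k
  ... | inj₁ n+1≤k = s≤s n+1≤k
  ... | inj₂ k≤n+1 = s≤s (two-deep-rows⇒teeth≤sources tip (inject₁ (fromℕ (suc n))) fromℕ≢inject₁
                            (≤-trans k≤n+1 (≤-trans (n≤1+n _) (≤-reflexive (sym (toℕ-fromℕ _)))))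
                            (≤-trans k≤n+1 (≤-reflexive (sym (trans (toℕ-inject₁ _) (toℕ-fromℕ _)))))
                            burnable)

  comb-burningNumber : BurningNumberIs G (1 + suc n)
  comb-burningNumber = (spine-tip-sources , spine-tip-sources-burn) , comb-burning-lower

lemma3p5 : (n : ℕ) → 1 ≤ n → BurningNumberIs (Comb n (n + 2)) (n + 1)
lemma3p5 (suc n) _ = subst₂ (λ m b → BurningNumberIs (Comb (suc n) m) b)
                            (+-comm 2 (suc n)) (+-comm 1 (suc n)) (comb-burningNumber n)
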